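{- Let $n_1,n_2\ge 0$ and let $w$ be a shortest walk from $(0,0)$ to $(n_1,n_2)$ staying in the first quadrant and using steps from $\{E=(1,0),W=(-1,0),NE=(1,1),SW=(-1,-1)\}$. Let $s(n_1,n_2)$ be the number of such shortest walks. (i) If $n_1 \ge n_2$ then $w$ uses $E$, $NE$ steps only, and \[ F(n_1;\,n_1,n_2)\ =\ s(n_1, n_2)\ =\ {n_1 \choose n_2}. \] (ii) If $n_1 \le n_2$ then $w$ uses $W$, $NE$ steps only, and \[ F(2n_2 - n_1;\,n_1,n_2)\ =\ s(n_1, n_2)\ =\ \frac{n_1+1}{2n_2-n_1+1}{2n_2-n_1+1 \choose n_2 + 1}. \]
   Context: $F(m;\, n_1,n_2)$ denotes the number of lattice walks from $(0,0)$ to $(n_1,n_2)$ that always stay in the first quadrant $\{(n_1,n_2);\ n_1 \ge 0, n_2 \ge 0\}$ and have exactly $m$ steps, each belonging to the set $\{E=(1,0),W=(-1,0),NE=(1,1),SW=(-1,-1)\}$. -}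

module Defs where

open import Data.Nat using (ℕ; zero; suc; _+_; _≤_)
open import Data.Bool using (Bool; true; false; _∧_)
open import Data.Product using (_×_; _,_; Σ)
open import Data.Maybe using (Maybe; just; nothing)
open import Data.List using (List; []; _∷_; length; concatMap; map)
open import Data.Sum using (_⊎_)
open import Relation.Binary.PropositionalEquality using (_≡_)

data Step : Set where
  E W NE SW : Step

allSteps : List Step
allSteps = E ∷ W ∷ NE ∷ SW ∷ []

step : Step → ℕ × ℕ → Maybe (ℕ × ℕ)
step E  (x , y) = just (suc x , y)
step W  (zero , y) = nothing
step W  (suc x , y) = just (x , y)
step NE (x , y) = just (suc x , suc y)
step SW (zero , y) = nothing
step SW (suc x , zero) = nothing
step SW (suc x , suc y) = just (x , y)

run : List Step → ℕ × ℕ → Maybe (ℕ × ℕ)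
run [] p = just p
run (s ∷ ss) p with step s p
... | nothing = nothing
... | just q  = run ss q

IsWalk : ℕ → ℕ → List Step → Set
IsWalk a b ws = run ws (0 , 0) ≡ just (a , b)

eqℕ : ℕ → ℕ → Bool
eqℕ zero zero = true
eqℕ (suc m) (suc n) = eqℕ m n
eqℕ _ _ = false

endsAt : ℕ → ℕ → Maybe (ℕ × ℕ) → Bool
endsAt a b (just (x , y)) = eqℕ a x ∧ eqℕ b y
endsAt a b nothing = false

allSeqs : ℕ → List (List Step)
allSeqs zero = [] ∷ []
allSeqs (suc m) = concatMap (λ s → map (s ∷_) (allSeqs m)) allSteps

count : {A : Set} → (A → Bool) → List A → ℕ
count p [] = 0
count p (x ∷ xs) with p x
... | true  = suc (count p xs)
... | false = count p xs

F : ℕ → ℕ → ℕ → ℕ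
F m a b = count (λ ws → endsAt a b (run ws (0 , 0))) (allSeqs m)

MinLength : ℕ → ℕ → ℕ → Set
MinLength m a b =
  Σ (List Step) (λ ws → IsWalk a b ws × length ws ≡ m)
  × ((ws : List Step) → IsWalk a b ws → m ≤ length ws)

ShortestWalk : ℕ → ℕ → List Step → Set
ShortestWalk a b ws =
  IsWalk a b ws × ((ws' : List Step) → IsWalk a b ws' → length ws ≤ length ws')

IsEorNE : Step → Set
IsEorNE s = s ≡ E ⊎ s ≡ NE

IsWorNE : Step → Set
IsWorNE s = s ≡ W ⊎ s ≡ NE

-- A potential is a map φ : ℕ × ℕ → ℤ which, along any step, grows by exactly one on a chosen set Q of
-- "rising" steps and does not grow on the other steps.  Summing along a walk from p to q shows that
-- its length is at least φ q - φ p, with equality only when every step rises.  The potential x (rising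
-- steps E, NE) gives the minimal length n₁ of part (i); the potential 2y - x (rising steps W, NE) gives
-- the minimal length 2n₂ - n₁ of part (ii).
--
-- For counting, walks Q m p a b is the number of length-m step sequences, all steps in Q, that lead from
-- p to (a , b).  It obeys a first-step recurrence, and for a target at exactly the minimal distance a
-- non-rising first step leads to an unreachable target; hence all walks of that length are rising walks.
-- Rising E/NE walks are counted by Pascal's rule, giving C(n₁, n₂).  Rising W/NE walks are ballot paths,
-- counted by the reflection formula C(L, u) - C(L, x + u + 1); an absorption identity for binomial
-- coefficients turns this into the closed form of part (ii).
module Submission where

open import Defs
open import Data.Nat using (ℕ; zero; suc; _+_; _*_; _∸_; _≤_; _<_; z≤n; s≤s)
import Data.Nat.Properties as ℕ
open import Data.Nat.Combinatorics
  using (_C_; nCk+nC[k+1]≡[n+1]C[k+1]; k>n⇒nCk≡0; nCn≡1; nCk≡nC[n∸k]; nC1≡n)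
open import Data.Nat.ListAction using (sum)
open import Algebra.Properties.CommutativeSemigroup ℕ.+-commutativeSemigroup using (interchange)
open import Data.Integer using (ℤ; +_; 1ℤ; _⊖_; +≤+; +<+)
  renaming (_+_ to _+ℤ_; _≤_ to _≤ℤ_; _<_ to _<ℤ_)
import Data.Integer.Properties as ℤ
open import Data.Bool using (Bool; true; false; _∧_; if_then_else_)
open import Data.Bool.Properties using (∧-zeroʳ; ∧-assoc; ∧-conicalˡ; ∧-conicalʳ)
open import Data.Bool.ListAction using (all)
open import Data.Product using (_×_; _,_; proj₁; proj₂; uncurry)
open import Data.Sum using (inj₁; inj₂)
open import Data.Maybe using (Maybe; just; nothing; _>>=_)
open import Data.List using (List; []; _∷_; _++_; map; concatMap; length; replicate)
open import Data.List.Properties using (map-cong; length-++; length-replicate)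
open import Data.List.Relation.Unary.All as All using (All; []; _∷_)
open import Data.List.Relation.Unary.All.Properties using (concat⁺; map⁺)
open import Data.Empty using (⊥; ⊥-elim)
open import Function using (_∘_)
open import Relation.Binary.PropositionalEquality
open ≡-Reasoning

count-++ : {A : Set} (p : A → Bool) (xs ys : List A) → count p (xs ++ ys) ≡ count p xs + count p ys
count-++ p []       ys = refl
count-++ p (x ∷ xs) ys with p x
... | true  = cong suc (count-++ p xs ys)
... | false = count-++ p xs ys

count-map : {A B : Set} (p : B → Bool) (f : A → B) (xs : List A) → count p (map f xs) ≡ count (p ∘ f) xs
count-map p f []       = refl
count-map p f (x ∷ xs) with p (f x)
... | true  = cong suc (count-map p f xs)
... | false = count-map p f xs

count-concatMap : {A B : Set} (p : B → Bool) (f : A → List B) (xs : List A) →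
  count p (concatMap f xs) ≡ sum (map (count p ∘ f) xs)
count-concatMap p f []       = refl
count-concatMap p f (x ∷ xs) =
  trans (count-++ p (f x) (concatMap f xs)) (cong (λ n → count p (f x) + n) (count-concatMap p f xs))

count-cong : {A : Set} {p q : A → Bool} → (∀ x → p x ≡ q x) → (xs : List A) → count p xs ≡ count q xs
count-cong e [] = refl
count-cong {p = p} {q} e (x ∷ xs) with p x | q x | e x
... | true  | .true  | refl = cong suc (count-cong e xs)
... | false | .false | refl = count-cong e xs

count-none : {A : Set} (p : A → Bool) {xs : List A} → All (λ x → p x ≡ false) xs → count p xs ≡ 0
count-none p []                 = refl
count-none p {x ∷ xs} (px ∷ pxs) with p x
count-none p (() ∷ pxs) | true
... | false = count-none p pxs

count-guard : {A : Set} (c : Bool) (p : A → Bool) (xs : List A) →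
  count (λ x → c ∧ p x) xs ≡ (if c then count p xs else 0)
count-guard true  p xs = refl
count-guard false p xs = count-none (λ _ → false) (All.universal (λ _ → refl) xs)

allSeqs-length : ∀ m → All (λ ws → length ws ≡ m) (allSeqs m)
allSeqs-length zero    = refl ∷ []
allSeqs-length (suc m) = concat⁺ (map⁺ (All.universal extend allSteps))
  where
  extend : ∀ s → All (λ ws → length ws ≡ suc m) (map (s ∷_) (allSeqs m))
  extend s = map⁺ (All.map (cong suc) (allSeqs-length m))

eqℕ-refl : ∀ n → eqℕ n n ≡ true
eqℕ-refl zero    = refl
eqℕ-refl (suc n) = eqℕ-refl n

eqℕ-sound : ∀ m n → eqℕ m n ≡ true → m ≡ n
eqℕ-sound zero    zero    e = refl
eqℕ-sound (suc m) (suc n) e = cong suc (eqℕ-sound m n e)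

endsAt-sound : ∀ a b r → endsAt a b r ≡ true → r ≡ just (a , b)
endsAt-sound a b (just (x , y)) e with eqℕ a x in ex | eqℕ b y in ey
... | true | true = cong₂ (λ u v → just (u , v)) (sym (eqℕ-sound a x ex)) (sym (eqℕ-sound b y ey))

run-∷ : ∀ s ws p → run (s ∷ ws) p ≡ (step s p >>= run ws)
run-∷ s ws p with step s p
... | nothing = refl
... | just q  = refl

walks : (Step → Bool) → ℕ → ℕ × ℕ → ℕ → ℕ → ℕ
walks Q m p a b = count (λ ws → all Q ws ∧ endsAt a b (run ws p)) (allSeqs m)

walksFrom : (Step → Bool) → ℕ → Maybe (ℕ × ℕ) → ℕ → ℕ → ℕ
walksFrom Q m nothing  a b = 0
walksFrom Q m (just p) a b = walks Q m p a b

firstStep : (Step → Bool) → Step → ℕ → ℕ × ℕ → ℕ → ℕ → ℕ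
firstStep Q s m p a b = if Q s then walksFrom Q m (step s p) a b else 0

walks-suc : ∀ Q m p a b → walks Q (suc m) p a b ≡ sum (map (λ s → firstStep Q s m p a b) allSteps)
walks-suc Q m p a b =
  trans (count-concatMap accepted (λ s → map (s ∷_) (allSeqs m)) allSteps)
        (cong sum (map-cong byFirst allSteps))
  where
  accepted : List Step → Bool
  accepted ws = all Q ws ∧ endsAt a b (run ws p)
  walksFrom-bind : ∀ r → count (λ ws → all Q ws ∧ endsAt a b (r >>= run ws)) (allSeqs m) ≡ walksFrom Q m r a b
  walksFrom-bind nothing  = count-none _ (All.universal (λ ws → ∧-zeroʳ (all Q ws)) (allSeqs m))
  walksFrom-bind (just q) = refl
  byFirst : ∀ s → count accepted (map (s ∷_) (allSeqs m)) ≡ firstStep Q s m p a b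
  byFirst s = begin
    count accepted (map (s ∷_) (allSeqs m))
      ≡⟨ count-map accepted (s ∷_) (allSeqs m) ⟩
    count (λ ws → (Q s ∧ all Q ws) ∧ endsAt a b (run (s ∷ ws) p)) (allSeqs m)
      ≡⟨ count-cong (λ ws → trans (∧-assoc (Q s) (all Q ws) _)
                                  (cong (λ r → Q s ∧ (all Q ws ∧ endsAt a b r)) (run-∷ s ws p))) (allSeqs m) ⟩
    count (λ ws → Q s ∧ (all Q ws ∧ endsAt a b (step s p >>= run ws))) (allSeqs m)
      ≡⟨ count-guard (Q s) _ (allSeqs m) ⟩
    (if Q s then count (λ ws → all Q ws ∧ endsAt a b (step s p >>= run ws)) (allSeqs m) else 0)
      ≡⟨ cong (if Q s then_else 0) (walksFrom-bind (step s p)) ⟩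
    firstStep Q s m p a b ∎

walks-here : ∀ Q a b → walks Q 0 (a , b) a b ≡ 1
walks-here Q a b rewrite eqℕ-refl a | eqℕ-refl b = refl

walks-zero : ∀ R S p a b → walks R 0 p a b ≡ walks S 0 p a b
walks-zero R S p a b with endsAt a b (just p)
... | true  = refl
... | false = refl

walks-unreachable : ∀ Q m p a b →
  (∀ ws → length ws ≡ m → all Q ws ≡ true → run ws p ≡ just (a , b) → ⊥) → walks Q m p a b ≡ 0
walks-unreachable Q m p a b noWalk = count-none _ (All.map (λ {ws} → fails ws) (allSeqs-length m))
  where
  fails : ∀ ws → length ws ≡ m → (all Q ws ∧ endsAt a b (run ws p)) ≡ false
  fails ws len with all Q ws in allQ | endsAt a b (run ws p) in ends
  ... | true  | true  = ⊥-elim (noWalk ws len allQ (endsAt-sound a b _ ends))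
  ... | true  | false = refl
  ... | false | _     = refl

anyStep : Step → Bool
anyStep _ = true

all-anyStep : ∀ ws → all anyStep ws ≡ true
all-anyStep []       = refl
all-anyStep (s ∷ ws) = all-anyStep ws

F-walks : ∀ m a b → F m a b ≡ walks anyStep m (0 , 0) a b
F-walks m a b = count-cong (λ ws → cong (_∧ endsAt a b (run ws (0 , 0))) (sym (all-anyStep ws))) (allSeqs m)

module Potential (Q : Step → Bool) (φ : ℕ × ℕ → ℤ)
  (rise : ∀ {s p p'} → step s p ≡ just p' → Q s ≡ true → φ p' ≡ 1ℤ +ℤ φ p)
  (fall : ∀ {s p p'} → step s p ≡ just p' → Q s ≡ false → φ p' ≤ℤ φ p) where

  shift : ∀ L i → + L +ℤ (1ℤ +ℤ i) ≡ + suc L +ℤ i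
  shift L i = trans (sym (ℤ.+-assoc (+ L) 1ℤ i)) (cong (_+ℤ i) (ℤ.+-comm (+ L) 1ℤ))

  step-bound : ∀ {s p p'} → step s p ≡ just p' → φ p' ≤ℤ 1ℤ +ℤ φ p
  step-bound {s} st with Q s in q
  ... | true  = ℤ.≤-reflexive (rise st q)
  ... | false = ℤ.≤-trans (fall st q) (ℤ.i≤suc[i] _)

  -- A non-rising step followed by L steps falls short of L + 1 units of gain.
  short-of-tight : ∀ L {i j} → i ≤ℤ j → + L +ℤ i <ℤ + suc L +ℤ j
  short-of-tight L {i} {j} i≤j =
    ℤ.≤-<-trans (ℤ.+-monoʳ-≤ (+ L) i≤j) (ℤ.+-monoˡ-< j (+<+ (ℕ.n<1+n L)))

  bound : ∀ ws {p q} → run ws p ≡ just q → φ q ≤ℤ + length ws +ℤ φ p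
  bound []       {p} refl = ℤ.≤-reflexive (sym (ℤ.+-identityˡ (φ p)))
  bound (s ∷ ws) {p} {q} r with step s p in st
  ... | just p' = ℤ.≤-trans (bound ws r)
                    (ℤ.≤-trans (ℤ.+-monoʳ-≤ (+ length ws) (step-bound st)) (ℤ.≤-reflexive (shift (length ws) (φ p))))

  tight-steps : ∀ ws {p q} → run ws p ≡ just q → φ q ≡ + length ws +ℤ φ p → All (λ s → Q s ≡ true) ws
  tight-steps []       r t = []
  tight-steps (s ∷ ws) {p} {q} r t with step s p in st
  ... | just p' with Q s in qs
  ...   | true  = qs ∷ tight-steps ws r
                         (trans t (sym (trans (cong (λ i → + length ws +ℤ i) (rise st qs)) (shift (length ws) (φ p)))))
  ...   | false = ⊥-elim (ℤ.<⇒≱ (short-of-tight (length ws) (fall st qs))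
                                 (ℤ.≤-trans (ℤ.≤-reflexive (sym t)) (bound ws r)))

  shortest : ∀ {a b} L w₀ → IsWalk a b w₀ → length w₀ ≡ L → φ (a , b) ≡ + L +ℤ φ (0 , 0) →
    MinLength L a b × (∀ w → ShortestWalk a b w → All (λ s → Q s ≡ true) w)
  shortest {a} {b} L w₀ walk len tight = ((w₀ , walk , len) , lower) , onlyRising
    where
    lower : ∀ ws → IsWalk a b ws → L ≤ length ws
    lower ws r = ℕ.≮⇒≥ λ short →
      ℤ.<⇒≱ (ℤ.+-monoˡ-< (φ (0 , 0)) (+<+ short)) (ℤ.≤-trans (ℤ.≤-reflexive (sym tight)) (bound ws r))
    onlyRising : ∀ w → ShortestWalk a b w → All (λ s → Q s ≡ true) w
    onlyRising w (r , minimal) = tight-steps w r (trans tight (cong (λ n → + n +ℤ φ (0 , 0)) L≡len))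
      where
      L≡len : L ≡ length w
      L≡len = ℕ.≤-antisym (lower w r) (subst (length w ≤_) len (minimal w₀ walk))

  vanish : ∀ R m p a b → + m +ℤ φ p <ℤ φ (a , b) → walks R m p a b ≡ 0
  vanish R m p a b gap = walks-unreachable R m p a b
    λ ws len _ r → ℤ.<⇒≱ gap (subst (λ n → φ (a , b) ≤ℤ + n +ℤ φ p) len (bound ws r))

  tight-count : ∀ m p a b → φ (a , b) ≡ + m +ℤ φ p → walks anyStep m p a b ≡ walks Q m p a b
  tight-count zero    p a b t = walks-zero anyStep Q p a b
  tight-count (suc m) p a b t =
    trans (walks-suc anyStep m p a b) (trans (cong sum (map-cong sameTerm allSteps)) (sym (walks-suc Q m p a b)))
    where
    sameTerm : ∀ s → firstStep anyStep s m p a b ≡ firstStep Q s m p a b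
    sameTerm s with Q s in qs | step s p in st
    ... | true  | nothing = refl
    ... | false | nothing = refl
    ... | true  | just p' =
      tight-count m p' a b (trans t (sym (trans (cong (λ i → + m +ℤ i) (rise st qs)) (shift m (φ p)))))
    ... | false | just p' =
      vanish anyStep m p' a b (ℤ.<-≤-trans (short-of-tight m (fall st qs)) (ℤ.≤-reflexive (sym t)))

isEorNE : Step → Bool
isEorNE E  = true
isEorNE NE = true
isEorNE _  = false

isWorNE : Step → Bool
isWorNE W  = true
isWorNE NE = true
isWorNE _  = false

isNE : Step → Bool
isNE NE = true
isNE _  = false

toIsEorNE : ∀ {s} → isEorNE s ≡ true → IsEorNE s
toIsEorNE {E}  _ = inj₁ refl
toIsEorNE {NE} _ = inj₂ refl

toIsWorNE : ∀ {s} → isWorNE s ≡ true → IsWorNE s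
toIsWorNE {W}  _ = inj₁ refl
toIsWorNE {NE} _ = inj₂ refl

abscissa : ℕ × ℕ → ℤ
abscissa (x , y) = + x

abscissa-rise : ∀ {s p p'} → step s p ≡ just p' → isEorNE s ≡ true → abscissa p' ≡ 1ℤ +ℤ abscissa p
abscissa-rise {E}  refl _ = refl
abscissa-rise {NE} refl _ = refl

abscissa-fall : ∀ {s p p'} → step s p ≡ just p' → isEorNE s ≡ false → abscissa p' ≤ℤ abscissa p
abscissa-fall {W}  {suc x , y}     refl _ = +≤+ (ℕ.n≤1+n x)
abscissa-fall {SW} {suc x , suc y} refl _ = +≤+ (ℕ.n≤1+n x)

module Abscissa = Potential isEorNE abscissa abscissa-rise abscissa-fall

height : ℕ × ℕ → ℤ
height (x , y) = + y

height-rise : ∀ {s p p'} → step s p ≡ just p' → isNE s ≡ true → height p' ≡ 1ℤ +ℤ height p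
height-rise {NE} refl _ = refl

height-fall : ∀ {s p p'} → step s p ≡ just p' → isNE s ≡ false → height p' ≤ℤ height p
height-fall {E}  refl _ = ℤ.≤-refl
height-fall {W}  {suc x , y}     refl _ = ℤ.≤-refl
height-fall {SW} {suc x , suc y} refl _ = +≤+ (ℕ.n≤1+n y)

module Height = Potential isNE height height-rise height-fall

tilt : ℕ × ℕ → ℤ
tilt (x , y) = (y + y) ⊖ x

tilt-diagonal : ∀ x y → tilt (suc x , suc y) ≡ 1ℤ +ℤ tilt (x , y)
tilt-diagonal x y = begin
  (suc y + suc y) ⊖ suc x   ≡⟨ cong (λ n → suc n ⊖ suc x) (ℕ.+-suc y y) ⟩
  suc (suc (y + y)) ⊖ suc x ≡⟨ ℤ.[1+m]⊖[1+n]≡m⊖n (suc (y + y)) x ⟩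
  suc (y + y) ⊖ x           ≡⟨ ℤ.distribʳ-⊖-+-pos 1 (y + y) x ⟨
  1ℤ +ℤ ((y + y) ⊖ x)       ∎

tilt-rise : ∀ {s p p'} → step s p ≡ just p' → isWorNE s ≡ true → tilt p' ≡ 1ℤ +ℤ tilt p
tilt-rise {W}  {suc x , y} refl _ =
  sym (trans (ℤ.distribʳ-⊖-+-pos 1 (y + y) (suc x)) (ℤ.[1+m]⊖[1+n]≡m⊖n (y + y) x))
tilt-rise {NE} {x , y}     refl _ = tilt-diagonal x y

tilt-fall : ∀ {s p p'} → step s p ≡ just p' → isWorNE s ≡ false → tilt p' ≤ℤ tilt p
tilt-fall {E}  {x , y}         refl _ = ℤ.⊖-monoʳ-≥-≤ (y + y) (ℕ.n≤1+n x)
tilt-fall {SW} {suc x , suc y} refl _ =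
  ℤ.≤-trans (ℤ.i≤suc[i] (tilt (x , y))) (ℤ.≤-reflexive (sym (tilt-diagonal x y)))

module Tilt = Potential isWorNE tilt tilt-rise tilt-fall

height-monotone : ∀ Q → Q SW ≡ false → ∀ ws {x y a b} → all Q ws ≡ true → run ws (x , y) ≡ just (a , b) → y ≤ b
height-monotone Q noSW []        allQ refl = ℕ.≤-refl
height-monotone Q noSW (E ∷ ws)  allQ r = height-monotone Q noSW ws (∧-conicalʳ _ _ allQ) r
height-monotone Q noSW (W ∷ ws) {suc x} allQ r = height-monotone Q noSW ws (∧-conicalʳ _ _ allQ) r
height-monotone Q noSW (NE ∷ ws) allQ r = ℕ.<⇒≤ (height-monotone Q noSW ws (∧-conicalʳ _ _ allQ) r)
height-monotone Q noSW (SW ∷ ws) allQ r with () ← trans (sym noSW) (∧-conicalˡ _ _ allQ)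

walks-below : ∀ Q → Q SW ≡ false → ∀ m x y a b → b < y → walks Q m (x , y) a b ≡ 0
walks-below Q noSW m x y a b b<y = walks-unreachable Q m (x , y) a b
  λ ws _ allQ r → ℕ.<⇒≱ b<y (height-monotone Q noSW ws allQ r)

nC0≡1 : ∀ n → n C 0 ≡ 1
nC0≡1 n = trans (nCk≡nC[n∸k] {0} {n} z≤n) (nCn≡1 n)

_C⁻_ : ℕ → ℕ → ℕ
n C⁻ zero  = 0
n C⁻ suc k = n C k

pascal : ∀ n k → n C k + n C⁻ k ≡ suc n C k
pascal n zero    = trans (ℕ.+-identityʳ (n C 0)) (trans (nC0≡1 n) (sym (nC0≡1 (suc n))))
pascal n (suc k) = trans (ℕ.+-comm (n C suc k) (n C k)) (nCk+nC[k+1]≡[n+1]C[k+1] n k)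

absorption : ∀ n k → suc k * (suc n C suc k) ≡ suc n * (n C k)
absorption n zero = begin
  1 * (suc n C 1) ≡⟨ ℕ.*-identityˡ _ ⟩
  suc n C 1       ≡⟨ nC1≡n (suc n) ⟩
  suc n           ≡⟨ ℕ.*-identityʳ (suc n) ⟨
  suc n * 1       ≡⟨ cong (suc n *_) (nC0≡1 n) ⟨
  suc n * (n C 0) ∎
absorption zero (suc k) = begin
  suc (suc k) * (1 C suc (suc k)) ≡⟨ cong (suc (suc k) *_) (k>n⇒nCk≡0 {1} {suc (suc k)} (s≤s (s≤s z≤n))) ⟩
  suc (suc k) * 0                 ≡⟨ ℕ.*-zeroʳ (suc (suc k)) ⟩
  0                               ≡⟨ cong (1 *_) (k>n⇒nCk≡0 {0} {suc k} (s≤s z≤n)) ⟨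
  1 * (0 C suc k)                 ∎
absorption (suc n) (suc k) = begin
  suc (suc k) * (suc (suc n) C suc (suc k))
    ≡⟨ cong (suc (suc k) *_) (nCk+nC[k+1]≡[n+1]C[k+1] (suc n) (suc k)) ⟨
  suc (suc k) * (X + Y)
    ≡⟨ ℕ.*-distribˡ-+ (suc (suc k)) X Y ⟩
  (X + suc k * X) + suc (suc k) * Y
    ≡⟨ ℕ.+-assoc X (suc k * X) _ ⟩
  X + (suc k * X + suc (suc k) * Y)
    ≡⟨ cong (λ z → X + z) (cong₂ _+_ (absorption n k) (absorption n (suc k))) ⟩
  X + (suc n * (n C k) + suc n * (n C suc k))
    ≡⟨ cong (λ z → X + z) (ℕ.*-distribˡ-+ (suc n) (n C k) (n C suc k)) ⟨
  X + suc n * (n C k + n C suc k)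
    ≡⟨ cong (λ z → X + suc n * z) (nCk+nC[k+1]≡[n+1]C[k+1] n k) ⟩
  suc (suc n) * X ∎
  where
  X = suc n C suc k
  Y = suc n C suc (suc k)

-- With k = n₁ + w and L = k + w: if B = C(L, k) - C(L, k + 1) then (L + 1) B = (n₁ + 1) C(L + 1, k + 1).
ballot-closed-form : ∀ n₁ w B → B + (n₁ + w + w) C suc (n₁ + w) ≡ (n₁ + w + w) C (n₁ + w) →
  suc (n₁ + w + w) * B ≡ suc n₁ * (suc (n₁ + w + w) C suc (n₁ + w))
ballot-closed-form n₁ w B reflection = ℕ.+-cancelʳ-≡ (suc L * R) (suc L * B) (suc n₁ * X) (begin
  suc L * B + suc L * R  ≡⟨ ℕ.*-distribˡ-+ (suc L) B R ⟨
  suc L * (B + R)        ≡⟨ cong (suc L *_) reflection ⟩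
  suc L * (L C k)        ≡⟨ absorption L k ⟨
  suc k * X              ≡⟨ ℕ.*-distribʳ-+ X (suc n₁) w ⟩
  suc n₁ * X + w * X     ≡⟨ cong (λ z → suc n₁ * X + z) complement ⟩
  suc n₁ * X + suc L * R ∎)
  where
  k = n₁ + w
  L = k + w
  X = suc L C suc k
  R = L C suc k
  complement : w * X ≡ suc L * R
  complement = ℕ.+-cancelˡ-≡ (suc k * X) (w * X) (suc L * R) (begin
    suc k * X + w * X           ≡⟨ ℕ.*-distribʳ-+ X (suc k) w ⟨
    suc L * X                   ≡⟨ cong (suc L *_) (nCk+nC[k+1]≡[n+1]C[k+1] L k) ⟨
    suc L * (L C k + R)         ≡⟨ ℕ.*-distribˡ-+ (suc L) (L C k) R ⟩
    suc L * (L C k) + suc L * R ≡⟨ cong (_+ suc L * R) (absorption L k) ⟨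
    suc k * X + suc L * R       ∎)

walks-EorNE-suc : ∀ m x y a b →
  walks isEorNE (suc m) (x , y) a b ≡ walks isEorNE m (suc x , y) a b + walks isEorNE m (suc x , suc y) a b
walks-EorNE-suc m x y a b =
  trans (walks-suc isEorNE m (x , y) a b) (cong (λ n → walks isEorNE m (suc x , y) a b + n) (ℕ.+-identityʳ _))

walks-WorNE-suc : ∀ m x y a b →
  walks isWorNE (suc m) (x , y) a b
    ≡ walksFrom isWorNE m (step W (x , y)) a b + walks isWorNE m (suc x , suc y) a b
walks-WorNE-suc m x y a b =
  trans (walks-suc isWorNE m (x , y) a b) (cong (λ n → walksFrom isWorNE m (step W (x , y)) a b + n) (ℕ.+-identityʳ _))

-- An E/NE walk of length m moves right by m; it is determined by which k of its steps are NE.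
EorNE-count : ∀ m x y k → walks isEorNE m (x , y) (x + m) (y + k) ≡ m C k
EorNE-count zero x y zero = subst₂ (λ a b → walks isEorNE 0 (x , y) a b ≡ 1)
  (sym (ℕ.+-identityʳ x)) (sym (ℕ.+-identityʳ y)) (walks-here isEorNE x y)
EorNE-count zero x y (suc k) =
  Height.vanish isEorNE 0 (x , y) (x + 0) (y + suc k) (+<+ (ℕ.m<m+n y (s≤s z≤n)))
EorNE-count (suc m) x y k = begin
  walks isEorNE (suc m) (x , y) (x + suc m) (y + k)
    ≡⟨ walks-EorNE-suc m x y (x + suc m) (y + k) ⟩
  walks isEorNE m (suc x , y) (x + suc m) (y + k) + walks isEorNE m (suc x , suc y) (x + suc m) (y + k)
    ≡⟨ cong₂ _+_ east (northeast k) ⟩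
  m C k + m C⁻ k
    ≡⟨ pascal m k ⟩
  suc m C k ∎
  where
  east : walks isEorNE m (suc x , y) (x + suc m) (y + k) ≡ m C k
  east = subst (λ a → walks isEorNE m (suc x , y) a (y + k) ≡ m C k) (sym (ℕ.+-suc x m)) (EorNE-count m (suc x) y k)
  northeast : ∀ k → walks isEorNE m (suc x , suc y) (x + suc m) (y + k) ≡ m C⁻ k
  northeast zero    =
    walks-below isEorNE refl m (suc x) (suc y) (x + suc m) (y + 0) (s≤s (ℕ.≤-reflexive (ℕ.+-identityʳ y)))
  northeast (suc k) = subst₂ (λ a b → walks isEorNE m (suc x , suc y) a b ≡ m C k)
    (sym (ℕ.+-suc x m)) (sym (ℕ.+-suc y k)) (EorNE-count m (suc x) (suc y) k)

-- Reflection principle: W/NE walks from abscissa x with u NE steps and w W steps number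
-- C(u + w, u) - C(u + w, x + u + 1).  Both the walk count and the right-hand side satisfy the
-- first-step recurrence; the degenerate first steps are unreachable and match vanishing binomials.
ballot : ∀ m u w x y a → u + w ≡ m → x + u ≡ a + w →
  walks isWorNE m (x , y) a (y + u) + m C suc (x + u) ≡ m C u
ballot zero zero zero x y a refl xu = trans (ℕ.+-identityʳ _)
  (subst₂ (λ a' b' → walks isWorNE 0 (x , y) a' b' ≡ 1)
    (ℕ.+-cancelʳ-≡ 0 x a xu) (sym (ℕ.+-identityʳ y)) (walks-here isWorNE x y))
ballot (suc n) u w x y a uw xu = begin
  walks isWorNE (suc n) (x , y) a (y + u) + suc n C suc (x + u)
    ≡⟨ cong₂ _+_ (walks-WorNE-suc n x y a (y + u)) (sym (nCk+nC[k+1]≡[n+1]C[k+1] n (x + u))) ⟩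
  (West + Northeast) + (n C (x + u) + n C suc (x + u))
    ≡⟨ interchange West Northeast (n C (x + u)) (n C suc (x + u)) ⟩
  (West + n C (x + u)) + (Northeast + n C suc (x + u))
    ≡⟨ cong₂ _+_ (west-part x w uw xu) (northeast-part u uw xu) ⟩
  n C u + n C⁻ u
    ≡⟨ pascal n u ⟩
  suc n C u ∎
  where
  West = walksFrom isWorNE n (step W (x , y)) a (y + u)
  Northeast = walks isWorNE n (suc x , suc y) a (y + u)
  west-part : ∀ x w → u + w ≡ suc n → x + u ≡ a + w →
    walksFrom isWorNE n (step W (x , y)) a (y + u) + n C (x + u) ≡ n C u
  west-part zero    w       _  _  = refl
  west-part (suc x) (suc w) uw xu = ballot n u w x y a
    (ℕ.suc-injective (trans (sym (ℕ.+-suc u w)) uw)) (ℕ.suc-injective (trans xu (ℕ.+-suc a w)))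
  west-part (suc x) zero    uw xu = begin
    walks isWorNE n (x , y) a (y + u) + n C (suc x + u)
      ≡⟨ cong₂ _+_ (Height.vanish isWorNE n (x , y) a (y + u) (+<+ below-target)) (k>n⇒nCk≡0 {n} {suc x + u} n<x+u) ⟩
    0
      ≡⟨ k>n⇒nCk≡0 {n} {u} n<u ⟨
    n C u ∎
    where
    n<u : n < u
    n<u = ℕ.≤-reflexive (sym (trans (sym (ℕ.+-identityʳ u)) uw))
    n<x+u : n < suc x + u
    n<x+u = ℕ.<-≤-trans n<u (ℕ.m≤n+m u (suc x))
    below-target : n + y < y + u
    below-target = subst (_< y + u) (ℕ.+-comm y n) (ℕ.+-monoʳ-< y n<u)
  northeast-part : ∀ u → u + w ≡ suc n → x + u ≡ a + w →
    walks isWorNE n (suc x , suc y) a (y + u) + n C suc (x + u) ≡ n C⁻ u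
  northeast-part zero uw xu =
    cong₂ _+_ (walks-below isWorNE refl n (suc x) (suc y) a (y + 0) (s≤s (ℕ.≤-reflexive (ℕ.+-identityʳ y))))
              (k>n⇒nCk≡0 {n} {suc (x + 0)} (s≤s (ℕ.<⇒≤ n<x)))
    where
    n<x : n < x + 0
    n<x = subst (_≤ x + 0) uw (subst (w ≤_) (sym xu) (ℕ.m≤n+m w a))
  northeast-part (suc u) uw xu =
    subst₂ (λ b k → walks isWorNE n (suc x , suc y) a b + n C k ≡ n C u)
      (sym (ℕ.+-suc y u)) (cong suc (sym (ℕ.+-suc x u)))
      (ballot n u w (suc x) (suc y) a (ℕ.suc-injective uw) (trans (sym (ℕ.+-suc x u)) xu))

run-++ : ∀ xs ys p → run (xs ++ ys) p ≡ (run xs p >>= run ys)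
run-++ []       ys p = refl
run-++ (s ∷ xs) ys p with step s p
... | nothing = refl
... | just q  = run-++ xs ys q

run-NE : ∀ k x y → run (replicate k NE) (x , y) ≡ just (x + k , y + k)
run-NE zero    x y rewrite ℕ.+-identityʳ x | ℕ.+-identityʳ y = refl
run-NE (suc k) x y rewrite ℕ.+-suc x k | ℕ.+-suc y k = run-NE k (suc x) (suc y)

run-E : ∀ k x y → run (replicate k E) (x , y) ≡ just (x + k , y)
run-E zero    x y rewrite ℕ.+-identityʳ x = refl
run-E (suc k) x y rewrite ℕ.+-suc x k = run-E k (suc x) y

run-W : ∀ k x y → run (replicate k W) (x + k , y) ≡ just (x , y)
run-W zero    x y rewrite ℕ.+-identityʳ x = refl
run-W (suc k) x y rewrite ℕ.+-suc x k = run-W k x y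

diagonal-then : ∀ s n d → run (replicate n NE ++ replicate d s) (0 , 0) ≡ run (replicate d s) (n , n)
diagonal-then s n d =
  trans (run-++ (replicate n NE) (replicate d s) (0 , 0)) (cong (_>>= run (replicate d s)) (run-NE n 0 0))

length-diagonal-then : ∀ s n d → length (replicate n NE ++ replicate d s) ≡ n + d
length-diagonal-then s n d =
  trans (length-++ (replicate n NE)) (cong₂ _+_ (length-replicate n) (length-replicate d))

part-i : ∀ {n₁ n₂} d → n₂ + d ≡ n₁ →
  MinLength n₁ n₁ n₂
  × ((w : List Step) → ShortestWalk n₁ n₂ w → All IsEorNE w)
  × F n₁ n₁ n₂ ≡ n₁ C n₂
part-i {n₂ = n₂} d refl =
  proj₁ shortest , (λ v sh → All.map toIsEorNE (proj₂ shortest v sh)) , counted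
  where
  n₁ = n₂ + d
  tight : abscissa (n₁ , n₂) ≡ + n₁ +ℤ abscissa (0 , 0)
  tight = cong +_ (sym (ℕ.+-identityʳ n₁))
  reaches : IsWalk n₁ n₂ (replicate n₂ NE ++ replicate d E)
  reaches = trans (diagonal-then E n₂ d) (run-E d n₂ n₂)
  shortest : MinLength n₁ n₁ n₂ × (∀ v → ShortestWalk n₁ n₂ v → All (λ s → isEorNE s ≡ true) v)
  shortest = Abscissa.shortest n₁ (replicate n₂ NE ++ replicate d E) reaches (length-diagonal-then E n₂ d) tight
  counted : F n₁ n₁ n₂ ≡ n₁ C n₂
  counted = begin
    F n₁ n₁ n₂                     ≡⟨ F-walks n₁ n₁ n₂ ⟩
    walks anyStep n₁ (0 , 0) n₁ n₂ ≡⟨ Abscissa.tight-count n₁ (0 , 0) n₁ n₂ tight ⟩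
    walks isEorNE n₁ (0 , 0) n₁ n₂ ≡⟨ EorNE-count n₁ 0 0 n₂ ⟩
    n₁ C n₂                        ∎

double-split : ∀ n₁ w → (n₁ + w) + (n₁ + w) ≡ n₁ + ((n₁ + w) + w)
double-split n₁ w = trans (ℕ.+-assoc n₁ w (n₁ + w)) (cong (λ z → n₁ + z) (ℕ.+-comm w (n₁ + w)))

excess-length : ∀ n₁ w → 2 * (n₁ + w) ∸ n₁ ≡ (n₁ + w) + w
excess-length n₁ w = begin
  2 * (n₁ + w) ∸ n₁        ≡⟨ cong (λ z → (n₁ + w) + z ∸ n₁) (ℕ.+-identityʳ (n₁ + w)) ⟩
  (n₁ + w) + (n₁ + w) ∸ n₁ ≡⟨ cong (_∸ n₁) (double-split n₁ w) ⟩
  n₁ + ((n₁ + w) + w) ∸ n₁ ≡⟨ ℕ.m+n∸m≡n n₁ ((n₁ + w) + w) ⟩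
  (n₁ + w) + w             ∎

part-ii : ∀ {n₁ n₂} w → n₁ + w ≡ n₂ →
  MinLength (2 * n₂ ∸ n₁) n₁ n₂
  × ((v : List Step) → ShortestWalk n₁ n₂ v → All IsWorNE v)
  × suc (2 * n₂ ∸ n₁) * F (2 * n₂ ∸ n₁) n₁ n₂ ≡ suc n₁ * (suc (2 * n₂ ∸ n₁) C suc n₂)
part-ii {n₁} w refl rewrite excess-length n₁ w =
  proj₁ shortest , (λ v sh → All.map toIsWorNE (proj₂ shortest v sh)) , counted
  where
  n₂ = n₁ + w
  L = n₂ + w
  tight : tilt (n₁ , n₂) ≡ + L +ℤ tilt (0 , 0)
  tight = trans (cong₂ _⊖_ (double-split n₁ w) (sym (ℕ.+-identityʳ n₁)))
                (trans (ℤ.+-cancelˡ-⊖ n₁ L 0) (cong +_ (sym (ℕ.+-identityʳ L))))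
  reaches : IsWalk n₁ n₂ (replicate n₂ NE ++ replicate w W)
  reaches = trans (diagonal-then W n₂ w) (run-W w n₁ n₂)
  shortest : MinLength L n₁ n₂ × (∀ v → ShortestWalk n₁ n₂ v → All (λ s → isWorNE s ≡ true) v)
  shortest = Tilt.shortest L (replicate n₂ NE ++ replicate w W) reaches (length-diagonal-then W n₂ w) tight
  counted : suc L * F L n₁ n₂ ≡ suc n₁ * (suc L C suc n₂)
  counted = ballot-closed-form n₁ w (F L n₁ n₂) (begin
    F L n₁ n₂ + L C suc n₂                     ≡⟨ cong (_+ L C suc n₂) (F-walks L n₁ n₂) ⟩
    walks anyStep L (0 , 0) n₁ n₂ + L C suc n₂ ≡⟨ cong (_+ L C suc n₂) (Tilt.tight-count L (0 , 0) n₁ n₂ tight) ⟩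
    walks isWorNE L (0 , 0) n₁ n₂ + L C suc n₂ ≡⟨ ballot L n₂ w 0 0 n₁ refl refl ⟩
    L C n₂                                     ∎)

theorem2 : (n₁ n₂ : ℕ) →
    (n₂ ≤ n₁ →
      MinLength n₁ n₁ n₂
      × ((w : List Step) → ShortestWalk n₁ n₂ w → All IsEorNE w)
      × F n₁ n₁ n₂ ≡ n₁ C n₂)
    × (n₁ ≤ n₂ →
      MinLength (2 * n₂ ∸ n₁) n₁ n₂
      × ((w : List Step) → ShortestWalk n₁ n₂ w → All IsWorNE w)
      × suc (2 * n₂ ∸ n₁) * F (2 * n₂ ∸ n₁) n₁ n₂
          ≡ suc n₁ * (suc (2 * n₂ ∸ n₁) C suc n₂))
theorem2 n₁ n₂ =
  (λ n₂≤n₁ → uncurry part-i (ℕ.m≤n⇒∃[o]m+o≡n n₂≤n₁)) ,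
  (λ n₁≤n₂ → uncurry part-ii (ℕ.m≤n⇒∃[o]m+o≡n n₁≤n₂))
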